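{- Let $k$ be odd and $1\le k<n$. If $n$ is even then $m(1,J(n,k))\le k+1$; if $n$ is odd then $m(1,J(n,k))\le 2k+1$.
   Context: $J(n,k)$ is the Johnson graph on the $k$-subsets of $\{1,\dots,n\}$ (adjacent iff they meet in $k-1$ elements); $\theta_1(J(n,k))=(k-1)(n-k-1)-1$ is its second largest eigenvalue. NZI means all entries nonzero integers; $m(1,J(n,k))=\min\{\|v\|_\infty+1: v\text{ an NZI }\theta_1(J(n,k))\text{ -eigenvector of }J(n,k)\}$. -}

module Defs where

open import Data.Bool using (Bool; true; false)
open import Data.Nat as ℕ using (ℕ; zero; suc; _∸_; _≟_)
open import Data.Integer as ℤ using (ℤ; +_) renaming (∣_∣ to abs)
open import Data.List using (foldr; List; []; _∷_; _++_; map; filter; sum)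
open import Data.Vec using (_∷_; [])
open import Data.Fin.Subset using (Subset; _∩_; ∣_∣)
open import Data.Product using (Σ; _×_; _,_; ∃)
open import Relation.Binary.PropositionalEquality using (_≡_; _≢_)
open import Relation.Nullary using (Dec; yes; no)

allSubsets : (n : ℕ) → List (Subset n)
allSubsets zero = [] ∷ []
allSubsets (suc n) = map (true ∷_) (allSubsets n) ++ map (false ∷_) (allSubsets n)

IsVertex : (n k : ℕ) → Subset n → Set
IsVertex n k A = ∣ A ∣ ≡ k

Adjacent? : {n : ℕ} (k : ℕ) (A B : Subset n) → Dec (∣ A ∣ ≡ k × ∣ B ∣ ≡ k × ∣ A ∩ B ∣ ≡ k ∸ 1)
Adjacent? k A B with ∣ A ∣ ≟ k | ∣ B ∣ ≟ k | ∣ A ∩ B ∣ ≟ k ∸ 1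
... | yes p | yes q | yes r = yes (p , q , r)
... | no ¬p | _ | _ = no (λ { (p , _ , _) → ¬p p })
... | yes _ | no ¬q | _ = no (λ { (_ , q , _) → ¬q q })
... | yes _ | yes _ | no ¬r = no (λ { (_ , _ , r) → ¬r r })

neighbours : (n k : ℕ) → Subset n → List (Subset n)
neighbours n k A = filter (Adjacent? k A) (allSubsets n)

-- (J(n,k) v)(A) = Σ_{B ~ A} v(B)   (vectors: functions on subsets, only values on k-subsets matter)
adjApply : (n k : ℕ) → (Subset n → ℤ) → Subset n → ℤ
adjApply n k v A = foldr ℤ._+_ (+ 0) (map v (neighbours n k A))

theta1 : (n k : ℕ) → ℤ
theta1 n k = (+ ((k ∸ 1) ℕ.* (n ∸ k ∸ 1))) ℤ.- (+ 1)

IsEigenvector : (n k : ℕ) → ℤ → (Subset n → ℤ) → Set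
IsEigenvector n k θ v = ∀ A → IsVertex n k A → adjApply n k v A ≡ θ ℤ.* v A

IsNZI : (n k : ℕ) → (Subset n → ℤ) → Set
IsNZI n k v = ∀ A → IsVertex n k A → v A ≢ + 0

-- m(1,J(n,k)) ≤ b  :⇔  some NZI θ₁-eigenvector v has ‖v‖∞ + 1 ≤ b
-- (unfolding of min{‖v‖∞+1 : v NZI θ₁-eigenvector} ≤ b)
m1Le : (n k b : ℕ) → Set
m1Le n k b = ∃ λ (v : Subset n → ℤ) →
  IsEigenvector n k (theta1 n k) v × IsNZI n k v × (∀ A → IsVertex n k A → suc (abs (v A)) ℕ.≤ b)

{-# OPTIONS --safe #-}
module Submission where

open import Defs
open import Data.Bool using (true; false; if_then_else_)
open import Data.Nat as ℕ using (ℕ; zero; suc; _∸_; _%_; _≤_; _<_; _≟_; z≤n; s≤s)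
import Data.Nat.Properties as ℕP
open import Data.Nat.DivMod using (_/_; m≡m%n+[m/n]*n; m*n%n≡0)
open import Data.Nat.Tactic.RingSolver renaming (solve-∀ to ℕ-solve-∀)
open import Data.Integer as ℤ using (ℤ; +_; -[1+_]; 0ℤ; 1ℤ; -1ℤ; _+_; _*_; -_; _-_; _⊖_)
import Data.Integer.Properties as ℤP
open import Algebra.Properties.AbelianGroup ℤP.+-0-abelianGroup using (inverseʳ-unique)
open import Data.Integer.Tactic.RingSolver using (solve-∀)
open import Data.List as List using (List; foldr; filter)
import Data.List.Properties as List
open import Data.Vec using (Vec; []; _∷_; replicate)
open import Data.Fin.Subset using (Subset; inside; outside; _∩_; ∁; ⊤; ∣_∣)
open import Data.Fin.Subset.Properties using (∣∁p∣≡n∸∣p∣; ∣⊤∣≡n)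
open import Data.Product using (_×_; _,_; ∃; ∃₂)
open import Function using (_∘_; _⇔_; mk⇔)
open import Relation.Binary.PropositionalEquality
open import Relation.Nullary using (Dec; does; _×-dec_)
open import Relation.Nullary.Decidable using (does-⇔)
open import Relation.Unary using (Pred; Decidable)

-- For weights w on {1, …, n} with Σ w = 0, the function v(A) = Σ_{i∈A} wᵢ is a
-- θ₁-eigenvector of J(n, k): the neighbours of a k-set A are A - a + c with
-- a ∈ A, c ∉ A, and summing gives (k - 1)(n - k) v(A) - (n - k) v(A) + k v(∁ A),
-- which is θ₁ v(A) because v(∁ A) = - v(A). Formally the neighbour sum is
-- computed by induction on n, for all sets B with ∣ A ∩ B ∣ = j and ∣ B ∖ A ∣ = d
-- at once, where it is a binomial expression.
--
-- If n = 2h, take h weights 1 and h weights -1: then v(A) = p - q with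
-- p + q = k odd, so 0 < ∣ v(A) ∣ ≤ k. If n = k + 2 + 2s, take -(k + 1), then
-- s + k + 1 weights 1 and s weights -1: v(A) is p - q with p + q = k, or
-- p - (k + 1 + q) with p + q = k - 1, so 0 < ∣ v(A) ∣ ≤ 2k.

𝟙 : ∀ {p} {P : Set p} → Dec P → ℤ
𝟙 P? = if does P? then 1ℤ else 0ℤ

𝟙-⇔ : ∀ {p q} {P : Set p} {Q : Set q} (P? : Dec P) (Q? : Dec Q) → P ⇔ Q → 𝟙 P? ≡ 𝟙 Q?
𝟙-⇔ P? Q? P⇔Q = cong (if_then 1ℤ else 0ℤ) (does-⇔ P⇔Q P? Q?)

𝟙-×-dec : ∀ {p q} {P : Set p} {Q : Set q} (P? : Dec P) (Q? : Dec Q) → 𝟙 (P? ×-dec Q?) ≡ 𝟙 P? * 𝟙 Q?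
𝟙-×-dec P? Q? with does P? | does Q?
... | true  | true  = refl
... | true  | false = refl
... | false | _     = refl

sumSubsets : ∀ n → (Subset n → ℤ) → ℤ
sumSubsets zero    f = f []
sumSubsets (suc n) f = sumSubsets n (f ∘ (inside ∷_)) + sumSubsets n (f ∘ (outside ∷_))

sumSubsets-cong : ∀ n {f g : Subset n → ℤ} → (∀ B → f B ≡ g B) → sumSubsets n f ≡ sumSubsets n g
sumSubsets-cong zero    f≗g = f≗g []
sumSubsets-cong (suc n) f≗g =
  cong₂ _+_ (sumSubsets-cong n (f≗g ∘ (inside ∷_))) (sumSubsets-cong n (f≗g ∘ (outside ∷_)))

sumSubsets-zero : ∀ n {f : Subset n → ℤ} → (∀ B → f B ≡ 0ℤ) → sumSubsets n f ≡ 0ℤ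
sumSubsets-zero zero    f≗0 = f≗0 []
sumSubsets-zero (suc n) f≗0 =
  cong₂ _+_ (sumSubsets-zero n (f≗0 ∘ (inside ∷_))) (sumSubsets-zero n (f≗0 ∘ (outside ∷_)))

sumSubsets-distrib : ∀ n (g h : Subset n → ℤ) x →
  sumSubsets n (λ B → g B * (x + h B)) ≡ x * sumSubsets n g + sumSubsets n (λ B → g B * h B)
sumSubsets-distrib zero    g h x = distrib (g []) x (h [])
  where
  distrib : ∀ a x b → a * (x + b) ≡ x * a + a * b
  distrib = solve-∀
sumSubsets-distrib (suc n) g h x = trans
  (cong₂ _+_ (sumSubsets-distrib n _ _ x) (sumSubsets-distrib n _ _ x))
  (regroup x _ _ _ _)
  where
  regroup : ∀ x a b c d → (x * a + b) + (x * c + d) ≡ x * (a + c) + (b + d)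
  regroup = solve-∀

foldr-+-filter : ∀ {a p} {A : Set a} {P : Pred A p} (P? : Decidable P) (f : A → ℤ) xs →
  foldr _+_ 0ℤ (List.map f (filter P? xs)) ≡ foldr _+_ 0ℤ (List.map (λ x → 𝟙 (P? x) * f x) xs)
foldr-+-filter P? f List.[] = refl
foldr-+-filter P? f (x List.∷ xs) with does (P? x)
... | true  = cong₂ _+_ (sym (ℤP.*-identityˡ (f x))) (foldr-+-filter P? f xs)
... | false = trans (foldr-+-filter P? f xs) (sym (ℤP.+-identityˡ _))

foldr-+-++ : ∀ (xs ys : List ℤ) → foldr _+_ 0ℤ (xs List.++ ys) ≡ foldr _+_ 0ℤ xs + foldr _+_ 0ℤ ys
foldr-+-++ List.[]       ys = sym (ℤP.+-identityˡ _)
foldr-+-++ (x List.∷ xs) ys = trans (cong (_+_ x) (foldr-+-++ xs ys)) (sym (ℤP.+-assoc x _ _))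

foldr-+-allSubsets : ∀ n (f : Subset n → ℤ) → foldr _+_ 0ℤ (List.map f (allSubsets n)) ≡ sumSubsets n f
foldr-+-allSubsets zero    f = ℤP.+-identityʳ (f [])
foldr-+-allSubsets (suc n) f = begin
    foldr _+_ 0ℤ (List.map f (List.map (inside ∷_) Bs List.++ List.map (outside ∷_) Bs))
  ≡⟨ cong (foldr _+_ 0ℤ) (List.map-++ f (List.map (inside ∷_) Bs) _) ⟩
    foldr _+_ 0ℤ (List.map f (List.map (inside ∷_) Bs) List.++ List.map f (List.map (outside ∷_) Bs))
  ≡⟨ foldr-+-++ (List.map f (List.map (inside ∷_) Bs)) _ ⟩
    foldr _+_ 0ℤ (List.map f (List.map (inside ∷_) Bs)) + foldr _+_ 0ℤ (List.map f (List.map (outside ∷_) Bs))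
  ≡⟨ cong₂ _+_ (cong (foldr _+_ 0ℤ) (sym (List.map-∘ Bs))) (cong (foldr _+_ 0ℤ) (sym (List.map-∘ Bs))) ⟩
    foldr _+_ 0ℤ (List.map (f ∘ (inside ∷_)) Bs) + foldr _+_ 0ℤ (List.map (f ∘ (outside ∷_)) Bs)
  ≡⟨ cong₂ _+_ (foldr-+-allSubsets n _) (foldr-+-allSubsets n _) ⟩
    sumSubsets (suc n) f ∎
  where
  open ≡-Reasoning
  Bs : List (Subset n)
  Bs = allSubsets n

weight : ∀ {n} → Vec ℤ n → Subset n → ℤ
weight []      []            = 0ℤ
weight (x ∷ w) (inside  ∷ A) = x + weight w A
weight (x ∷ w) (outside ∷ A) = weight w A

∣p∣≡0⇒weight≡0 : ∀ {n} (w : Vec ℤ n) (A : Subset n) → ∣ A ∣ ≡ 0 → weight w A ≡ 0ℤ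
∣p∣≡0⇒weight≡0 []      []            _ = refl
∣p∣≡0⇒weight≡0 (x ∷ w) (outside ∷ A) e = ∣p∣≡0⇒weight≡0 w A e

weight-∁ : ∀ {n} (w : Vec ℤ n) (A : Subset n) → weight w A + weight w (∁ A) ≡ weight w ⊤
weight-∁ []      []            = refl
weight-∁ (x ∷ w) (inside  ∷ A) = trans (ℤP.+-assoc x _ _) (cong (_+_ x) (weight-∁ w A))
weight-∁ (x ∷ w) (outside ∷ A) = trans (swap (weight w A) x _) (cong (_+_ x) (weight-∁ w A))
  where
  swap : ∀ a x b → a + (x + b) ≡ x + (a + b)
  swap = solve-∀

-- Binomial coefficients by Pascal's rule, valued in ℤ so that the recursion
-- holds definitionally in the subset-sum inductions.
choose : ℕ → ℕ → ℤ
choose m       zero    = 1ℤ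
choose zero    (suc r) = 0ℤ
choose (suc m) (suc r) = choose m r + choose m (suc r)

-- choose₁ m r = choose (m - 1) (r - 1) counts the r-subsets of an m-set that
-- contain a given point; it is 0 when m = 0 or r = 0.
choose₁ : ℕ → ℕ → ℤ
choose₁ m       zero    = 0ℤ
choose₁ zero    (suc r) = 0ℤ
choose₁ (suc m) (suc r) = choose m r

choose₁-pascal : ∀ m r → choose₁ (suc m) r + choose₁ (suc m) (suc r) ≡ choose (suc m) r
choose₁-pascal m zero    = refl
choose₁-pascal m (suc r) = refl

m<n⇒choose[m,n]≡0 : ∀ {m r} → m ℕ.< r → choose m r ≡ 0ℤ
m<n⇒choose[m,n]≡0 {zero}  {suc r} _         = refl
m<n⇒choose[m,n]≡0 {suc m} {suc r} (s≤s m<r) =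
  cong₂ _+_ (m<n⇒choose[m,n]≡0 m<r) (m<n⇒choose[m,n]≡0 (ℕP.m<n⇒m<1+n m<r))

choose[n,n]≡1 : ∀ n → choose n n ≡ 1ℤ
choose[n,n]≡1 zero    = refl
choose[n,n]≡1 (suc n) = cong₂ _+_ (choose[n,n]≡1 n) (m<n⇒choose[m,n]≡0 (ℕP.n<1+n n))

choose[1+n,n]≡1+n : ∀ n → choose (suc n) n ≡ + suc n
choose[1+n,n]≡1+n zero    = refl
choose[1+n,n]≡1+n (suc n) = begin
  choose (suc n) n + choose (suc n) (suc n) ≡⟨ cong₂ _+_ (choose[1+n,n]≡1+n n) (choose[n,n]≡1 (suc n)) ⟩
  + suc n + 1ℤ                             ≡⟨ ℤP.pos-+ (suc n) 1 ⟨
  + (suc n ℕ.+ 1)                          ≡⟨ cong (+_ ∘ suc) (ℕP.+-comm n 1) ⟩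
  + suc (suc n)                            ∎
  where open ≡-Reasoning

choose₁[1+n,n]≡n : ∀ n → choose₁ (suc n) n ≡ + n
choose₁[1+n,n]≡n zero    = refl
choose₁[1+n,n]≡n (suc n) = choose[1+n,n]≡1+n n

choose[n,1]≡n : ∀ n → choose n 1 ≡ + n
choose[n,1]≡n zero    = refl
choose[n,1]≡n (suc n) = trans (cong (_+_ 1ℤ) (choose[n,1]≡n n)) (sym (ℤP.pos-+ 1 n))

δ : ℕ → ℕ → ℤ
δ a b = 𝟙 (a ≟ b)

-- The indicator of ∣ A ∩ B ∣ = j and ∣ B ∖ A ∣ = d; the neighbours of a k-set A
-- in J(n, k) are the B with j = k - 1 and d = 1.
meets : ∀ {n} → Subset n → ℕ → ℕ → Subset n → ℤ
meets A j d B = δ ∣ A ∩ B ∣ j * (δ ∣ ∁ A ∩ B ∣ d)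

-- Pascal's rule fails for choose₁ at m = 0, but then A is empty and has weight 0.
weight*choose₁-pascal : ∀ {n} (w : Vec ℤ n) (A : Subset n) r →
  weight w A * (choose₁ ∣ A ∣ r + (choose₁ ∣ A ∣ (suc r))) ≡ weight w A * choose ∣ A ∣ r
weight*choose₁-pascal w A r with ∣ A ∣ in ∣A∣≡
... | suc a = cong (weight w A *_) (choose₁-pascal a r)
... | zero rewrite ∣p∣≡0⇒weight≡0 w A ∣A∣≡ = refl

sum-meets : ∀ {n} (A : Subset n) j d → sumSubsets n (meets A j d) ≡ choose ∣ A ∣ j * (choose ∣ ∁ A ∣ d)
sum-meets []            zero    zero    = refl
sum-meets []            zero    (suc d) = refl
sum-meets []            (suc j) d       = refl
sum-meets {suc n} (inside ∷ A) zero d =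
  trans (cong₂ _+_ (sumSubsets-zero n (λ _ → refl)) (sum-meets A zero d)) (ℤP.+-identityˡ _)
sum-meets (inside ∷ A) (suc j) d =
  trans (cong₂ _+_ (sum-meets A j d) (sum-meets A (suc j) d))
        (sym (ℤP.*-distribʳ-+ (choose ∣ ∁ A ∣ d) (choose ∣ A ∣ j) _))
sum-meets {suc n} (outside ∷ A) j zero =
  trans (cong₂ _+_ (sumSubsets-zero n (λ B → ℤP.*-zeroʳ (δ ∣ A ∩ B ∣ j))) (sum-meets A j zero))
        (ℤP.+-identityˡ _)
sum-meets (outside ∷ A) j (suc d) =
  trans (cong₂ _+_ (sum-meets A j d) (sum-meets A j (suc d)))
        (sym (ℤP.*-distribˡ-+ (choose ∣ A ∣ j) (choose ∣ ∁ A ∣ d) _))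

-- A point of A lies in choose₁ ∣ A ∣ j · choose ∣ ∁ A ∣ d of the sets B counted
-- by meets A j d, a point outside A in choose ∣ A ∣ j · choose₁ ∣ ∁ A ∣ d of them.
sum-meets-weight : ∀ {n} (w : Vec ℤ n) (A : Subset n) j d →
  sumSubsets n (λ B → meets A j d B * weight w B)
    ≡ weight w A * (choose₁ ∣ A ∣ j) * (choose ∣ ∁ A ∣ d) + weight w (∁ A) * (choose ∣ A ∣ j) * (choose₁ ∣ ∁ A ∣ d)
sum-meets-weight []      []            j d = ℤP.*-zeroʳ (meets [] j d [])
sum-meets-weight {suc n} (x ∷ w) (inside ∷ A) (suc j) d = begin
    sumSubsets n (λ B → meets A j d B * (x + weight w B)) + sumSubsets n (λ B → meets A (suc j) d B * weight w B)
  ≡⟨ cong (_+ _) (sumSubsets-distrib n (meets A j d) (weight w) x) ⟩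
    x * sumSubsets n (meets A j d) + sumSubsets n (λ B → meets A j d B * weight w B)
      + sumSubsets n (λ B → meets A (suc j) d B * weight w B)
  ≡⟨ cong₂ _+_ (cong₂ _+_ (cong (x *_) (sum-meets A j d)) (sum-meets-weight w A j d)) (sum-meets-weight w A (suc j) d) ⟩
    x * (Cj * Cd) + (wA * C₁j * Cd + wC * Cj * C₁d) + (wA * C₁sj * Cd + wC * Csj * C₁d)
  ≡⟨ regroup x wA wC Cj Csj C₁j C₁sj Cd C₁d ⟩
    (x * Cj + wA * (C₁j + C₁sj)) * Cd + wC * (Cj + Csj) * C₁d
  ≡⟨ cong (λ t → (x * Cj + t) * Cd + wC * (Cj + Csj) * C₁d) (weight*choose₁-pascal w A j) ⟩
    (x * Cj + wA * Cj) * Cd + wC * (Cj + Csj) * C₁d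
  ≡⟨ cong (_+ wC * (Cj + Csj) * C₁d) (collect x wA Cj Cd) ⟩
    (x + wA) * Cj * Cd + wC * (Cj + Csj) * C₁d
  ∎
  where
  open ≡-Reasoning
  wA = weight w A
  wC = weight w (∁ A)
  Cj = choose ∣ A ∣ j
  Csj = choose ∣ A ∣ (suc j)
  C₁j = choose₁ ∣ A ∣ j
  C₁sj = choose₁ ∣ A ∣ (suc j)
  Cd = choose ∣ ∁ A ∣ d
  C₁d = choose₁ ∣ ∁ A ∣ d
  regroup : ∀ x wA wC Cj Csj C₁j C₁sj Cd C₁d →
    x * (Cj * Cd) + (wA * C₁j * Cd + wC * Cj * C₁d) + (wA * C₁sj * Cd + wC * Csj * C₁d)
      ≡ (x * Cj + wA * (C₁j + C₁sj)) * Cd + wC * (Cj + Csj) * C₁d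
  regroup = solve-∀
  collect : ∀ x wA Cj Cd → (x * Cj + wA * Cj) * Cd ≡ (x + wA) * Cj * Cd
  collect = solve-∀
sum-meets-weight {suc n} (x ∷ w) (inside ∷ A) zero d = begin
    sumSubsets n (λ _ → 0ℤ) + sumSubsets n (λ B → meets A zero d B * weight w B)
  ≡⟨ cong₂ _+_ (sumSubsets-zero n (λ _ → refl)) (sum-meets-weight w A zero d) ⟩
    0ℤ + (weight w A * 0ℤ * Cd + wC * 1ℤ * C₁d)
  ≡⟨ absorb x (weight w A) wC Cd C₁d ⟩
    (x + weight w A) * 0ℤ * Cd + wC * 1ℤ * C₁d
  ∎
  where
  open ≡-Reasoning
  wC = weight w (∁ A)
  Cd = choose ∣ ∁ A ∣ d
  C₁d = choose₁ ∣ ∁ A ∣ d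
  absorb : ∀ x wA wC Cd C₁d → 0ℤ + (wA * 0ℤ * Cd + wC * 1ℤ * C₁d) ≡ (x + wA) * 0ℤ * Cd + wC * 1ℤ * C₁d
  absorb = solve-∀
sum-meets-weight {suc n} (x ∷ w) (outside ∷ A) j zero = begin
    sumSubsets n (λ B → δ ∣ A ∩ B ∣ j * 0ℤ * (x + weight w B)) + sumSubsets n (λ B → meets A j zero B * weight w B)
  ≡⟨ cong₂ _+_ (sumSubsets-zero n (λ B → cong (_* (x + weight w B)) (ℤP.*-zeroʳ (δ ∣ A ∩ B ∣ j))))
               (sum-meets-weight w A j zero) ⟩
    0ℤ + (wA * C₁j * 1ℤ + weight w (∁ A) * Cj * 0ℤ)
  ≡⟨ absorb x wA (weight w (∁ A)) Cj C₁j ⟩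
    wA * C₁j * 1ℤ + (x + weight w (∁ A)) * Cj * 0ℤ
  ∎
  where
  open ≡-Reasoning
  wA = weight w A
  Cj = choose ∣ A ∣ j
  C₁j = choose₁ ∣ A ∣ j
  absorb : ∀ x wA wC Cj C₁j → 0ℤ + (wA * C₁j * 1ℤ + wC * Cj * 0ℤ) ≡ wA * C₁j * 1ℤ + (x + wC) * Cj * 0ℤ
  absorb = solve-∀
sum-meets-weight {suc n} (x ∷ w) (outside ∷ A) j (suc d) = begin
    sumSubsets n (λ B → meets A j d B * (x + weight w B)) + sumSubsets n (λ B → meets A j (suc d) B * weight w B)
  ≡⟨ cong (_+ _) (sumSubsets-distrib n (meets A j d) (weight w) x) ⟩
    x * sumSubsets n (meets A j d) + sumSubsets n (λ B → meets A j d B * weight w B)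
      + sumSubsets n (λ B → meets A j (suc d) B * weight w B)
  ≡⟨ cong₂ _+_ (cong₂ _+_ (cong (x *_) (sum-meets A j d)) (sum-meets-weight w A j d)) (sum-meets-weight w A j (suc d)) ⟩
    x * (Cj * Cd) + (wA * C₁j * Cd + wC * Cj * C₁d) + (wA * C₁j * Csd + wC * Cj * C₁sd)
  ≡⟨ regroup x wA wC Cj C₁j Cd Csd C₁d C₁sd ⟩
    wA * C₁j * (Cd + Csd) + Cj * (x * Cd + wC * (C₁d + C₁sd))
  ≡⟨ cong (λ t → wA * C₁j * (Cd + Csd) + Cj * (x * Cd + t)) (weight*choose₁-pascal w (∁ A) d) ⟩
    wA * C₁j * (Cd + Csd) + Cj * (x * Cd + wC * Cd)
  ≡⟨ cong (_+_ (wA * C₁j * (Cd + Csd))) (collect x wC Cj Cd) ⟩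
    wA * C₁j * (Cd + Csd) + (x + wC) * Cj * Cd
  ∎
  where
  open ≡-Reasoning
  wA = weight w A
  wC = weight w (∁ A)
  Cj = choose ∣ A ∣ j
  C₁j = choose₁ ∣ A ∣ j
  Cd = choose ∣ ∁ A ∣ d
  Csd = choose ∣ ∁ A ∣ (suc d)
  C₁d = choose₁ ∣ ∁ A ∣ d
  C₁sd = choose₁ ∣ ∁ A ∣ (suc d)
  regroup : ∀ x wA wC Cj C₁j Cd Csd C₁d C₁sd →
    x * (Cj * Cd) + (wA * C₁j * Cd + wC * Cj * C₁d) + (wA * C₁j * Csd + wC * Cj * C₁sd)
      ≡ wA * C₁j * (Cd + Csd) + Cj * (x * Cd + wC * (C₁d + C₁sd))
  regroup = solve-∀
  collect : ∀ x wC Cj Cd → Cj * (x * Cd + wC * Cd) ≡ (x + wC) * Cj * Cd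
  collect = solve-∀

∣p∣≡∣q∩p∣+∣∁q∩p∣ : ∀ {n} (A B : Subset n) → ∣ B ∣ ≡ ∣ A ∩ B ∣ ℕ.+ ∣ ∁ A ∩ B ∣
∣p∣≡∣q∩p∣+∣∁q∩p∣ []            []            = refl
∣p∣≡∣q∩p∣+∣∁q∩p∣ (inside  ∷ A) (inside  ∷ B) = cong suc (∣p∣≡∣q∩p∣+∣∁q∩p∣ A B)
∣p∣≡∣q∩p∣+∣∁q∩p∣ (outside ∷ A) (inside  ∷ B) =
  trans (cong suc (∣p∣≡∣q∩p∣+∣∁q∩p∣ A B)) (sym (ℕP.+-suc _ _))
∣p∣≡∣q∩p∣+∣∁q∩p∣ (inside  ∷ A) (outside ∷ B) = ∣p∣≡∣q∩p∣+∣∁q∩p∣ A B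
∣p∣≡∣q∩p∣+∣∁q∩p∣ (outside ∷ A) (outside ∷ B) = ∣p∣≡∣q∩p∣+∣∁q∩p∣ A B

adjacent⇔meets : ∀ {n j} {A B : Subset n} → ∣ A ∣ ≡ suc j →
  (∣ A ∣ ≡ suc j × ∣ B ∣ ≡ suc j × ∣ A ∩ B ∣ ≡ j) ⇔ (∣ A ∩ B ∣ ≡ j × ∣ ∁ A ∩ B ∣ ≡ 1)
adjacent⇔meets {j = j} {A} {B} ∣A∣≡ = mk⇔
  (λ (_ , ∣B∣≡ , ∣A∩B∣≡) → ∣A∩B∣≡ , ℕP.+-cancelˡ-≡ j _ _ (begin
      j ℕ.+ ∣ ∁ A ∩ B ∣              ≡⟨ cong (ℕ._+ ∣ ∁ A ∩ B ∣) ∣A∩B∣≡ ⟨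
      ∣ A ∩ B ∣ ℕ.+ ∣ ∁ A ∩ B ∣      ≡⟨ ∣p∣≡∣q∩p∣+∣∁q∩p∣ A B ⟨
      ∣ B ∣                          ≡⟨ trans ∣B∣≡ (ℕP.+-comm 1 j) ⟩
      j ℕ.+ 1                        ∎))
  (λ (∣A∩B∣≡ , ∣∁A∩B∣≡) → ∣A∣≡ , trans (∣p∣≡∣q∩p∣+∣∁q∩p∣ A B)
      (trans (cong₂ ℕ._+_ ∣A∩B∣≡ ∣∁A∩B∣≡) (ℕP.+-comm j 1)) , ∣A∩B∣≡)
  where open ≡-Reasoning

adjApply≡sumSubsets-meets : ∀ {n j} (v : Subset n → ℤ) (A : Subset n) → ∣ A ∣ ≡ suc j →
  adjApply n (suc j) v A ≡ sumSubsets n (λ B → meets A j 1 B * v B)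
adjApply≡sumSubsets-meets {n} {j} v A ∣A∣≡ = begin
    foldr _+_ 0ℤ (List.map v (filter (Adjacent? (suc j) A) (allSubsets n)))
  ≡⟨ foldr-+-filter (Adjacent? (suc j) A) v (allSubsets n) ⟩
    foldr _+_ 0ℤ (List.map (λ B → 𝟙 (Adjacent? (suc j) A B) * v B) (allSubsets n))
  ≡⟨ foldr-+-allSubsets n _ ⟩
    sumSubsets n (λ B → 𝟙 (Adjacent? (suc j) A B) * v B)
  ≡⟨ sumSubsets-cong n (λ B → cong (_* v B) (indicator B)) ⟩
    sumSubsets n (λ B → meets A j 1 B * v B) ∎
  where
  open ≡-Reasoning
  indicator : ∀ B → 𝟙 (Adjacent? (suc j) A B) ≡ meets A j 1 B
  indicator B = trans (𝟙-⇔ (Adjacent? (suc j) A B) (∣ A ∩ B ∣ ≟ j ×-dec ∣ ∁ A ∩ B ∣ ≟ 1)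
                             (adjacent⇔meets {A = A} {B} ∣A∣≡))
                      (𝟙-×-dec (∣ A ∩ B ∣ ≟ j) (∣ ∁ A ∩ B ∣ ≟ 1))

-- With ∣ A ∣ = j + 1, ∣ ∁ A ∣ = m + 1 and W′ = - W this is j (m + 1) W - (j + 1) W = (j m - 1) W.
θ₁-identity : ∀ {a c} {W W′ : ℤ} j m → a ≡ suc j → c ≡ suc m → W + W′ ≡ 0ℤ →
  W * choose₁ a j * choose c 1 + W′ * choose a j * choose₁ c 1 ≡ (+ (j ℕ.* m) - 1ℤ) * W
θ₁-identity {W = W} {W′} j m refl refl W+W′≡0 = begin
    W * choose₁ (suc j) j * choose (suc m) 1 + W′ * choose (suc j) j * 1ℤ
  ≡⟨ cong₂ (λ t u → W * t * choose (suc m) 1 + W′ * u * 1ℤ) (choose₁[1+n,n]≡n j) (choose[1+n,n]≡1+n j) ⟩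
    W * + j * choose (suc m) 1 + W′ * + suc j * 1ℤ
  ≡⟨ cong₂ (λ t u → W * + j * t + u * + suc j * 1ℤ) (choose[n,1]≡n (suc m)) (inverseʳ-unique W W′ W+W′≡0) ⟩
    W * + j * + suc m + (- W) * + suc j * 1ℤ
  ≡⟨ cong₂ (λ t u → W * + j * t + (- W) * u * 1ℤ) (ℤP.pos-+ 1 m) (ℤP.pos-+ 1 j) ⟩
    W * + j * (1ℤ + + m) + (- W) * (1ℤ + + j) * 1ℤ
  ≡⟨ expand W (+ j) (+ m) ⟩
    (+ j * + m - 1ℤ) * W
  ≡⟨ cong (λ t → (t - 1ℤ) * W) (ℤP.pos-* j m) ⟨
    (+ (j ℕ.* m) - 1ℤ) * W ∎
  where
  open ≡-Reasoning
  expand : ∀ W j m → W * j * (1ℤ + m) + (- W) * (1ℤ + j) * 1ℤ ≡ (j * m - 1ℤ) * W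
  expand = solve-∀

weight-isEigenvector : ∀ {n k} (w : Vec ℤ n) → 1 ≤ k → k < n → weight w ⊤ ≡ 0ℤ →
  IsEigenvector n k (theta1 n k) (weight w)
weight-isEigenvector {n} {suc j} w (s≤s z≤n) k<n Σw≡0 A ∣A∣≡ = begin
    adjApply n (suc j) (weight w) A
  ≡⟨ adjApply≡sumSubsets-meets (weight w) A ∣A∣≡ ⟩
    sumSubsets n (λ B → meets A j 1 B * weight w B)
  ≡⟨ sum-meets-weight w A j 1 ⟩
    weight w A * (choose₁ ∣ A ∣ j) * (choose ∣ ∁ A ∣ 1) + weight w (∁ A) * (choose ∣ A ∣ j) * (choose₁ ∣ ∁ A ∣ 1)
  ≡⟨ θ₁-identity j (n ∸ suc j ∸ 1) ∣A∣≡ ∣∁A∣≡ (trans (weight-∁ w A) Σw≡0) ⟩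
    theta1 n (suc j) * weight w A ∎
  where
  open ≡-Reasoning
  instance
    n∸k≢0 : ℕ.NonZero (n ∸ suc j)
    n∸k≢0 = ℕ.>-nonZero (ℕP.m<n⇒0<n∸m k<n)
  ∣∁A∣≡ : ∣ ∁ A ∣ ≡ suc (n ∸ suc j ∸ 1)
  ∣∁A∣≡ = trans (∣∁p∣≡n∸∣p∣ A) (trans (cong (n ∸_) ∣A∣≡) (sym (ℕP.suc-pred (n ∸ suc j))))

signs : ∀ a b → Vec ℤ (a ℕ.+ b)
signs zero    b = replicate b -1ℤ
signs (suc a) b = 1ℤ ∷ signs a b

weight-replicate-1 : ∀ {b} (A : Subset b) → weight (replicate b -1ℤ) A ≡ 0 ⊖ ∣ A ∣
weight-replicate-1 []            = refl
weight-replicate-1 (inside  ∷ A) =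
  trans (cong (_+_ -1ℤ) (weight-replicate-1 A)) (ℤP.distribʳ-⊖-+-neg 0 0 ∣ A ∣)
weight-replicate-1 (outside ∷ A) = weight-replicate-1 A

weight-signs : ∀ a b (A : Subset (a ℕ.+ b)) → ∃₂ λ p q → p ℕ.+ q ≡ ∣ A ∣ × weight (signs a b) A ≡ p ⊖ q
weight-signs zero    b A             = 0 , ∣ A ∣ , refl , weight-replicate-1 A
weight-signs (suc a) b (outside ∷ A) = weight-signs a b A
weight-signs (suc a) b (inside  ∷ A) with weight-signs a b A
... | p , q , p+q≡∣A∣ , w≡p⊖q =
  suc p , q , cong suc p+q≡∣A∣ , trans (cong (_+_ 1ℤ) w≡p⊖q) (ℤP.distribʳ-⊖-+-pos 1 p q)

weight-signs-⊤ : ∀ a b → weight (signs a b) ⊤ ≡ a ⊖ b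
weight-signs-⊤ zero    b = trans (weight-replicate-1 {b} ⊤) (cong (0 ⊖_) (∣⊤∣≡n b))
weight-signs-⊤ (suc a) b = trans (cong (_+_ 1ℤ) (weight-signs-⊤ a b)) (ℤP.distribʳ-⊖-+-pos 1 a b)

m⊖n≡0⇒m≡n : ∀ {m n} → m ⊖ n ≡ 0ℤ → m ≡ n
m⊖n≡0⇒m≡n {m} {n} m⊖n≡0 = ℤP.+-injective (ℤP.i-j≡0⇒i≡j (+ m) (+ n) (trans (ℤP.[+m]-[+n]≡m⊖n m n) m⊖n≡0))

m*2≡m+m : ∀ m → m ℕ.* 2 ≡ m ℕ.+ m
m*2≡m+m = ℕ-solve-∀

[m+n]%2≡1⇒m≢n : ∀ m n → (m ℕ.+ n) % 2 ≡ 1 → m ≢ n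
[m+n]%2≡1⇒m≢n m .m odd refl = ℕP.0≢1+n (trans (sym (m*n%n≡0 m 2)) (trans (cong (_% 2) (m*2≡m+m m)) odd))

m≤n⇒1+m≤n+1 : ∀ {m n} → m ≤ n → suc m ≤ n ℕ.+ 1
m≤n⇒1+m≤n+1 {m} {n} m≤n = subst (suc m ≤_) (ℕP.+-comm 1 n) (s≤s m≤n)

m1Le-weight : ∀ {n k} b (w : Vec ℤ n) → 1 ≤ k → k < n → weight w ⊤ ≡ 0ℤ →
  (∀ A → ∣ A ∣ ≡ k → ∃₂ λ p q → (p ≢ q × p ℕ.⊔ q ≤ b) × weight w A ≡ p ⊖ q) →
  m1Le n k (b ℕ.+ 1)
m1Le-weight b w 1≤k k<n Σw≡0 as-⊖ = weight w , weight-isEigenvector w 1≤k k<n Σw≡0 , nonzero , bounded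
  where
  nonzero : ∀ A → ∣ A ∣ ≡ _ → weight w A ≢ 0ℤ
  nonzero A ∣A∣≡k with as-⊖ A ∣A∣≡k
  ... | p , q , (p≢q , _) , w≡p⊖q = p≢q ∘ m⊖n≡0⇒m≡n ∘ trans (sym w≡p⊖q)
  bounded : ∀ A → ∣ A ∣ ≡ _ → suc ℤ.∣ weight w A ∣ ≤ b ℕ.+ 1
  bounded A ∣A∣≡k with as-⊖ A ∣A∣≡k
  ... | p , q , (_ , p⊔q≤b) , w≡p⊖q rewrite w≡p⊖q = m≤n⇒1+m≤n+1 (ℕP.≤-trans (ℤP.∣m⊝n∣≤m⊔n p q) p⊔q≤b)

odd-sum-split : ∀ {p q k} → p ℕ.+ q ≡ k → k % 2 ≡ 1 → p ≢ q × p ℕ.⊔ q ≤ k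
odd-sum-split {p} {q} refl odd = [m+n]%2≡1⇒m≢n p q odd , ℕP.m⊔n≤m+n p q

m1Le-even : ∀ h k → k % 2 ≡ 1 → 1 ≤ k → k < h ℕ.+ h → m1Le (h ℕ.+ h) k (k ℕ.+ 1)
m1Le-even h k k-odd 1≤k k<n =
  m1Le-weight k (signs h h) 1≤k k<n (trans (weight-signs-⊤ h h) (ℤP.n⊖n≡0 h)) as-⊖
  where
  as-⊖ : ∀ A → ∣ A ∣ ≡ k → ∃₂ λ p q → (p ≢ q × p ℕ.⊔ q ≤ k) × weight (signs h h) A ≡ p ⊖ q
  as-⊖ A ∣A∣≡k with weight-signs h h A
  ... | p , q , p+q≡∣A∣ , w≡p⊖q = p , q , odd-sum-split (trans p+q≡∣A∣ ∣A∣≡k) k-odd , w≡p⊖q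

m1Le-odd : ∀ k s → k % 2 ≡ 1 → 1 ≤ k → m1Le (suc (suc k ℕ.+ s ℕ.+ s)) k (2 ℕ.* k ℕ.+ 1)
m1Le-odd k s k-odd 1≤k = m1Le-weight (2 ℕ.* k) w 1≤k k<n Σw≡0 as-⊖
  where
  w : Vec ℤ (suc (suc k ℕ.+ s ℕ.+ s))
  w = -[1+ k ] ∷ signs (suc k ℕ.+ s) s
  k<n : k < suc (suc k ℕ.+ s ℕ.+ s)
  k<n = s≤s (ℕP.≤-trans (ℕP.n≤1+n k) (ℕP.≤-trans (ℕP.m≤m+n (suc k) s) (ℕP.m≤m+n _ s)))
  k≤2k : k ≤ 2 ℕ.* k
  k≤2k = ℕP.m≤m+n k _
  Σw≡0 : weight w ⊤ ≡ 0ℤ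
  Σw≡0 = begin
    -[1+ k ] + weight (signs (suc k ℕ.+ s) s) ⊤ ≡⟨ cong (_+_ -[1+ k ]) (weight-signs-⊤ (suc k ℕ.+ s) s) ⟩
    -[1+ k ] + (suc k ℕ.+ s ⊖ s)                ≡⟨ ℤP.distribʳ-⊖-+-neg k (suc k ℕ.+ s) s ⟩
    suc k ℕ.+ s ⊖ (suc k ℕ.+ s)                 ≡⟨ ℤP.n⊖n≡0 (suc k ℕ.+ s) ⟩
    0ℤ                                          ∎
    where open ≡-Reasoning
  as-⊖ : ∀ A → ∣ A ∣ ≡ k → ∃₂ λ p q → (p ≢ q × p ℕ.⊔ q ≤ 2 ℕ.* k) × weight w A ≡ p ⊖ q
  as-⊖ (outside ∷ A) ∣A∣≡k with weight-signs (suc k ℕ.+ s) s A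
  ... | p , q , p+q≡∣A∣ , w≡p⊖q =
    let p≢q , p⊔q≤k = odd-sum-split (trans p+q≡∣A∣ ∣A∣≡k) k-odd
    in p , q , (p≢q , ℕP.≤-trans p⊔q≤k k≤2k) , w≡p⊖q
  as-⊖ (inside ∷ A) 1+∣A∣≡k with weight-signs (suc k ℕ.+ s) s A
  ... | p , q , p+q≡∣A∣ , w≡p⊖q =
    p , suc k ℕ.+ q , (ℕP.<⇒≢ p<1+k+q , ℕP.⊔-lub (ℕP.≤-trans p≤k k≤2k) 1+k+q≤2k) ,
    trans (cong (_+_ -[1+ k ]) w≡p⊖q) (ℤP.distribʳ-⊖-+-neg k p q)
    where
    1+p+q≡k : suc (p ℕ.+ q) ≡ k
    1+p+q≡k = trans (cong suc p+q≡∣A∣) 1+∣A∣≡k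
    p≤k : p ≤ k
    p≤k = ℕP.≤-trans (ℕP.m≤m+n p q) (subst (p ℕ.+ q ≤_) 1+p+q≡k (ℕP.n≤1+n _))
    p<1+k+q : p < suc k ℕ.+ q
    p<1+k+q = s≤s (ℕP.≤-trans p≤k (ℕP.m≤m+n k q))
    1+k+q≤2k : suc k ℕ.+ q ≤ 2 ℕ.* k
    1+k+q≤2k = begin
      suc k ℕ.+ q   ≡⟨ ℕP.+-suc k q ⟨
      k ℕ.+ suc q   ≤⟨ ℕP.+-monoʳ-≤ k (subst (suc q ≤_) 1+p+q≡k (s≤s (ℕP.m≤n+m q p))) ⟩
      k ℕ.+ k       ≡⟨ m*2≡m+m k ⟨
      k ℕ.* 2       ≡⟨ ℕP.*-comm k 2 ⟩
      2 ℕ.* k       ∎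
      where open ℕP.≤-Reasoning

n%2≡0⇒n≡h+h : ∀ n → n % 2 ≡ 0 → n ≡ n / 2 ℕ.+ n / 2
n%2≡0⇒n≡h+h n n%2≡0 = trans (m≡m%n+[m/n]*n n 2) (trans (cong (ℕ._+ n / 2 ℕ.* 2) n%2≡0) (m*2≡m+m (n / 2)))

n%2≡1⇒n≡1+h+h : ∀ n → n % 2 ≡ 1 → n ≡ suc (n / 2 ℕ.+ n / 2)
n%2≡1⇒n≡1+h+h n n%2≡1 = trans (m≡m%n+[m/n]*n n 2) (trans (cong (ℕ._+ n / 2 ℕ.* 2) n%2≡1) (cong suc (m*2≡m+m (n / 2))))

odd<odd⇒gap : ∀ {k n} → k % 2 ≡ 1 → n % 2 ≡ 1 → k < n → ∃ λ s → n ≡ suc (suc k ℕ.+ s ℕ.+ s)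
odd<odd⇒gap {k} {n} k%2≡1 n%2≡1 k<n = s , (begin
    n                                       ≡⟨ n≡1+h+h ⟩
    suc (h ℕ.+ h)                           ≡⟨ cong (λ h → suc (h ℕ.+ h)) h≡1+t+s ⟨
    suc (suc t ℕ.+ s ℕ.+ (suc t ℕ.+ s))     ≡⟨ regroup t s ⟩
    suc (suc (suc (t ℕ.+ t)) ℕ.+ s ℕ.+ s)   ≡⟨ cong (λ k → suc (suc k ℕ.+ s ℕ.+ s)) k≡1+t+t ⟨
    suc (suc k ℕ.+ s ℕ.+ s)                 ∎)
  where
  open ≡-Reasoning
  t h : ℕ
  t = k / 2
  h = n / 2
  k≡1+t+t : k ≡ suc (t ℕ.+ t)
  k≡1+t+t = n%2≡1⇒n≡1+h+h k k%2≡1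
  n≡1+h+h : n ≡ suc (h ℕ.+ h)
  n≡1+h+h = n%2≡1⇒n≡1+h+h n n%2≡1
  t<h : t < h
  t<h = ℕP.≰⇒> λ h≤t → ℕP.<⇒≱ (subst₂ _<_ k≡1+t+t n≡1+h+h k<n) (s≤s (ℕP.+-mono-≤ h≤t h≤t))
  s : ℕ
  s = h ∸ suc t
  h≡1+t+s : suc t ℕ.+ s ≡ h
  h≡1+t+s = ℕP.m+[n∸m]≡n t<h
  regroup : ∀ t s → suc (suc t ℕ.+ s ℕ.+ (suc t ℕ.+ s)) ≡ suc (suc (suc (t ℕ.+ t)) ℕ.+ s ℕ.+ s)
  regroup = ℕ-solve-∀

proposition6 : (n k : ℕ) → k % 2 ≡ 1 → 1 ≤ k → k < n →
    (n % 2 ≡ 0 → m1Le n k (k ℕ.+ 1)) × (n % 2 ≡ 1 → m1Le n k (2 ℕ.* k ℕ.+ 1))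
proposition6 n k k-odd 1≤k k<n = n-even , n-odd
  where
  n-even : n % 2 ≡ 0 → m1Le n k (k ℕ.+ 1)
  n-even n%2≡0 =
    subst (λ n → m1Le n k (k ℕ.+ 1)) (sym n≡h+h) (m1Le-even (n / 2) k k-odd 1≤k (subst (k <_) n≡h+h k<n))
    where
    n≡h+h : n ≡ n / 2 ℕ.+ n / 2
    n≡h+h = n%2≡0⇒n≡h+h n n%2≡0
  n-odd : n % 2 ≡ 1 → m1Le n k (2 ℕ.* k ℕ.+ 1)
  n-odd n%2≡1 with odd<odd⇒gap k-odd n%2≡1 k<n
  ... | s , n≡1+1+k+s+s = subst (λ n → m1Le n k (2 ℕ.* k ℕ.+ 1)) (sym n≡1+1+k+s+s) (m1Le-odd k s k-odd 1≤k)
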